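{- In the delimited control calculus described in the context, if $M$ is a closed computation with $\emptyset;\emptyset\vdash_{\emptyset}M:F\,G$ for a ground type $G$, then there exists a value $V$ with $\emptyset;\emptyset\vdash V:G$ and $M\to^{*}\mathtt{return}\,V$.
   Context: Core syntax. Values $V ::= x \mid () \mid (V_1,V_2) \mid \ell\,V \mid \{M\}$; computations $M,N ::= \mathtt{let}\,(x,y)=V\,\mathtt{in}\,M \mid \mathtt{case}\,V\,\mathtt{of}\,\{\ell_i x_i\mapsto M_i\}_i \mid V! \mid \mathtt{return}\,V \mid \mathtt{let}\,x\Leftarrow M\,\mathtt{in}\,N \mid \lambda x.M \mid M\,V \mid \langle M_1,M_2\rangle \mid \mathrm{prj}_i M \mid \mathcal{S}_0k.M\mid\langle M\mid x.N\rangle$ (shift-zero and reset). Core $\beta$-rules: $\mathtt{let}\,(x,y)=(V_1,V_2)\,\mathtt{in}\,M \to_\beta M[V_1/x,V_2/y]$; $\mathtt{case}\,\ell_j V\,\mathtt{of}\,\{\dots\ell_j x_j\mapsto M_j\dots\}\to_\beta M_j[V/x_j]$; $\{M\}!\to_\beta M$; $\mathtt{let}\,x\Leftarrow\mathtt{return}\,V\,\mathtt{in}\,N\to_\beta N[V/x]$; $(\lambda x.M)V\to_\beta M[V/x]$; $\mathrm{prj}_i\langle M_1,M_2\rangle\to_\beta M_i$; $\langle\mathtt{return}\,V\mid x.N\rangle\to_\beta N[V/x]$; $\langle\mathcal{H}[\mathcal{S}_0k.M]\mid x.N\rangle\to_\beta M[\{\lambda y.\langle\mathcal{H}[\mathtt{return}\,y]\mid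 x.N\rangle\}/k]$. Basic frames $B ::= \mathtt{let}\,x\Leftarrow[\,]\,\mathtt{in}\,N\mid[\,]\,V\mid\mathrm{prj}_i[\,]$; hoisting contexts $\mathcal{H}::=[\,]\mid\mathcal{H}[B]$; evaluation contexts $K::=[\,]\mid K[B]\mid K[\langle[\,]\mid x.N\rangle]$; $M\to N$ iff $M=K[M']$, $N=K[N']$, $M'\to_\beta N'$. Types. Effects $E::=\emptyset\mid E,C$ (stacks of computation types). Value types $A::=\alpha\mid 1\mid A_1\times A_2\mid\{\ell_i\ \mathrm{of}\ A_i\}_i\mid U_E C$; computation types $C::=F\,A\mid A\to C\mid C_1\&C_2$; ground types $G::=1\mid G_1\times G_2\mid\{\ell_1\ \mathrm{of}\ G_1\mid\dots\mid\ell_n\ \mathrm{of}\ G_n\}$. Core rules as standard call-by-push-value ($\{M\}:U_EC$ from $\vdash_E M:C$; $\vdash_E V!:C$ from $V:U_EC$; $\vdash_E\mathtt{return}\,V:FA$ from $V:A$; $\vdash_E\mathtt{let}\,x\Leftarrow M\,\mathtt{in}\,N:C$ from $\vdash_EM:FA$, $x:A\vdash_EN:C$; functions, application, pairs, variants, computation products standard, identical effects throughout). Shift: $\Gamma\vdash_{E,C}\mathcal{S}_0k.M:F\,A$ from $\Gamma,k:U_E(A\to C)\vdash_E M:C$. Reset: $\Gamma\vdash_E\langle M\mid x.N\rangle:C$ from $\Gamma\vdash_{E,C}M:F\,A$ and $\Gamma,x:A\vdash_EN:C$. -}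

module Defs where

open import Data.Nat using (ℕ; zero; suc)
open import Data.Fin using (Fin)
open import Data.List using (List; []; _∷_)
open import Data.List.Relation.Unary.All using (All)
open import Data.List.Relation.Binary.Pointwise using (Pointwise)
open import Data.Product using (Σ; ∃; _×_; _,_)
open import Relation.Binary.PropositionalEquality using (_≡_)
open import Relation.Binary.Construct.Closure.ReflexiveTransitive using (Star)

-- Variant labels ℓ_i are represented positionally: the i-th label of a
-- variant type is the natural number i.

mutual
  data Val : Set where
    var   : ℕ → Val
    unit  : Val
    pair  : Val → Val → Val
    inj   : ℕ → Val → Val
    thunk : Comp → Val

  data Comp : Set where
    letp   : Val → Comp → Comp          -- let (x,y) = V in M   (M binds x = 1, y = 0)
    case   : Val → List Comp → Comp     -- case V of {ℓ_i x_i ↦ M_i}_i (each M_i binds x_i = 0)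
    force  : Val → Comp
    ret    : Val → Comp
    bind   : Comp → Comp → Comp
    lam    : Comp → Comp
    app    : Comp → Val → Comp
    cpair  : Comp → Comp → Comp
    prj₁   : Comp → Comp
    prj₂   : Comp → Comp
    shift  : Comp → Comp                -- S₀k.M            (M binds k = 0)
    reset  : Comp → Comp → Comp         -- ⟨M | x.N⟩        (N binds x = 0)

ext : (ℕ → ℕ) → ℕ → ℕ
ext ρ zero    = zero
ext ρ (suc n) = suc (ρ n)

mutual
  renV : (ℕ → ℕ) → Val → Val
  renV ρ (var x)     = var (ρ x)
  renV ρ unit        = unit
  renV ρ (pair V W)  = pair (renV ρ V) (renV ρ W)
  renV ρ (inj i V)   = inj i (renV ρ V)
  renV ρ (thunk M)   = thunk (renC ρ M)

  renC : (ℕ → ℕ) → Comp → Comp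
  renC ρ (letp V M)    = letp (renV ρ V) (renC (ext (ext ρ)) M)
  renC ρ (case V Ms)   = case (renV ρ V) (renBs ρ Ms)
  renC ρ (force V)     = force (renV ρ V)
  renC ρ (ret V)       = ret (renV ρ V)
  renC ρ (bind M N)    = bind (renC ρ M) (renC (ext ρ) N)
  renC ρ (lam M)       = lam (renC (ext ρ) M)
  renC ρ (app M V)     = app (renC ρ M) (renV ρ V)
  renC ρ (cpair M N)   = cpair (renC ρ M) (renC ρ N)
  renC ρ (prj₁ M)      = prj₁ (renC ρ M)
  renC ρ (prj₂ M)      = prj₂ (renC ρ M)
  renC ρ (shift M)     = shift (renC (ext ρ) M)
  renC ρ (reset M N)   = reset (renC ρ M) (renC (ext ρ) N)

  renBs : (ℕ → ℕ) → List Comp → List Comp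
  renBs ρ []       = []
  renBs ρ (M ∷ Ms) = renC (ext ρ) M ∷ renBs ρ Ms

exts : (ℕ → Val) → ℕ → Val
exts σ zero    = var zero
exts σ (suc n) = renV suc (σ n)

mutual
  subV : (ℕ → Val) → Val → Val
  subV σ (var x)     = σ x
  subV σ unit        = unit
  subV σ (pair V W)  = pair (subV σ V) (subV σ W)
  subV σ (inj i V)   = inj i (subV σ V)
  subV σ (thunk M)   = thunk (subC σ M)

  subC : (ℕ → Val) → Comp → Comp
  subC σ (letp V M)    = letp (subV σ V) (subC (exts (exts σ)) M)
  subC σ (case V Ms)   = case (subV σ V) (subBs σ Ms)
  subC σ (force V)     = force (subV σ V)
  subC σ (ret V)       = ret (subV σ V)
  subC σ (bind M N)    = bind (subC σ M) (subC (exts σ) N)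
  subC σ (lam M)       = lam (subC (exts σ) M)
  subC σ (app M V)     = app (subC σ M) (subV σ V)
  subC σ (cpair M N)   = cpair (subC σ M) (subC σ N)
  subC σ (prj₁ M)      = prj₁ (subC σ M)
  subC σ (prj₂ M)      = prj₂ (subC σ M)
  subC σ (shift M)     = shift (subC (exts σ) M)
  subC σ (reset M N)   = reset (subC σ M) (subC (exts σ) N)

  subBs : (ℕ → Val) → List Comp → List Comp
  subBs σ []       = []
  subBs σ (M ∷ Ms) = subC (exts σ) M ∷ subBs σ Ms

single : Val → ℕ → Val
single V zero    = V
single V (suc n) = var n

_[_] : Comp → Val → Comp
M [ V ] = subC (single V) M

-- M[V₁/x, V₂/y] where x has index 1 and y has index 0
double : Val → Val → ℕ → Val
double V₁ V₂ zero          = V₂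
double V₁ V₂ (suc zero)    = V₁
double V₁ V₂ (suc (suc n)) = var n

data Frame : Set where
  bindF : Comp → Frame
  appF  : Val → Frame
  prj₁F : Frame
  prj₂F : Frame

plugB : Frame → Comp → Comp
plugB (bindF N) M = bind M N
plugB (appF V)  M = app M V
plugB prj₁F     M = prj₁ M
plugB prj₂F     M = prj₂ M

renF : (ℕ → ℕ) → Frame → Frame
renF ρ (bindF N) = bindF (renC (ext ρ) N)
renF ρ (appF V)  = appF (renV ρ V)
renF ρ prj₁F     = prj₁F
renF ρ prj₂F     = prj₂F

-- hoisting contexts H, listed innermost frame first:
-- plugH (B ∷ H) M = H[B[M]]
Hoist : Set
Hoist = List Frame

plugH : Hoist → Comp → Comp
plugH []      M = M
plugH (B ∷ H) M = plugH H (plugB B M)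

renH : (ℕ → ℕ) → Hoist → Hoist
renH ρ []      = []
renH ρ (B ∷ H) = renF ρ B ∷ renH ρ H

data EFrame : Set where
  basic  : Frame → EFrame
  resetF : Comp → EFrame

plugE : EFrame → Comp → Comp
plugE (basic B)  M = plugB B M
plugE (resetF N) M = reset M N

-- evaluation contexts K, listed innermost frame first
ECtx : Set
ECtx = List EFrame

plugK : ECtx → Comp → Comp
plugK []      M = M
plugK (F ∷ K) M = plugK K (plugE F M)

lookupC : List Comp → ℕ → Comp → Set
lookupC []       i       M = Data.Empty.⊥
  where import Data.Empty
lookupC (N ∷ Ns) zero    M = N ≡ M
lookupC (N ∷ Ns) (suc i) M = lookupC Ns i M

data _→β_ : Comp → Comp → Set where
  β-letp  : ∀ {V₁ V₂ M} → letp (pair V₁ V₂) M →β subC (double V₁ V₂) M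
  β-case  : ∀ {j V Ms Mj} → lookupC Ms j Mj → case (inj j V) Ms →β (Mj [ V ])
  β-force : ∀ {M} → force (thunk M) →β M
  β-bind  : ∀ {V N} → bind (ret V) N →β (N [ V ])
  β-app   : ∀ {M V} → app (lam M) V →β (M [ V ])
  β-prj₁  : ∀ {M₁ M₂} → prj₁ (cpair M₁ M₂) →β M₁
  β-prj₂  : ∀ {M₁ M₂} → prj₂ (cpair M₁ M₂) →β M₂
  β-reset : ∀ {V N} → reset (ret V) N →β (N [ V ])
  β-shift : ∀ {H M N} →
    reset (plugH H (shift M)) N →β
      (M [ thunk (lam (reset (plugH (renH suc H) (ret (var zero))) (renC (ext suc) N))) ])

data _⟶_ : Comp → Comp → Set where
  step : ∀ (K : ECtx) {M N} → M →β N → plugK K M ⟶ plugK K N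

_⟶*_ : Comp → Comp → Set
_⟶*_ = Star _⟶_

mutual
  data VTy (n : ℕ) : Set where
    tvar  : Fin n → VTy n
    𝟙     : VTy n
    _⊗_   : VTy n → VTy n → VTy n
    variant : List (VTy n) → VTy n
    U     : List (CTy n) → CTy n → VTy n

  data CTy (n : ℕ) : Set where
    F    : VTy n → CTy n
    _⇒_  : VTy n → CTy n → CTy n
    _&_  : CTy n → CTy n → CTy n

-- effects: stacks of computation types; E , C is represented as C ∷ E
Eff : ℕ → Set
Eff n = List (CTy n)

data Ground {n : ℕ} : VTy n → Set where
  g-unit    : Ground 𝟙
  g-pair    : ∀ {G₁ G₂} → Ground G₁ → Ground G₂ → Ground (G₁ ⊗ G₂)
  g-variant : ∀ {Gs} → All Ground Gs → Ground (variant Gs)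

data _∋_∶_ {a} {X : Set a} : List X → ℕ → X → Set a where
  here  : ∀ {A xs} → (A ∷ xs) ∋ zero ∶ A
  there : ∀ {A B xs i} → xs ∋ i ∶ A → (B ∷ xs) ∋ suc i ∶ A

mutual
  data _⊢v_∶_ {n : ℕ} (Γ : List (VTy n)) : Val → VTy n → Set where
    t-var   : ∀ {x A} → Γ ∋ x ∶ A → Γ ⊢v var x ∶ A
    t-unit  : Γ ⊢v unit ∶ 𝟙
    t-pair  : ∀ {V₁ V₂ A₁ A₂} → Γ ⊢v V₁ ∶ A₁ → Γ ⊢v V₂ ∶ A₂ → Γ ⊢v pair V₁ V₂ ∶ (A₁ ⊗ A₂)
    t-inj   : ∀ {i V As A} → As ∋ i ∶ A → Γ ⊢v V ∶ A → Γ ⊢v inj i V ∶ variant As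
    t-thunk : ∀ {M E C} → Γ ⊢[ E ] M ∶ C → Γ ⊢v thunk M ∶ U E C

  data _⊢[_]_∶_ {n : ℕ} (Γ : List (VTy n)) (E : Eff n) : Comp → CTy n → Set where
    t-letp  : ∀ {V M A₁ A₂ C} → Γ ⊢v V ∶ (A₁ ⊗ A₂) → (A₂ ∷ A₁ ∷ Γ) ⊢[ E ] M ∶ C →
              Γ ⊢[ E ] letp V M ∶ C
    t-case  : ∀ {V Ms As C} → Γ ⊢v V ∶ variant As →
              Pointwise (λ A M → (A ∷ Γ) ⊢[ E ] M ∶ C) As Ms →
              Γ ⊢[ E ] case V Ms ∶ C
    t-force : ∀ {V C} → Γ ⊢v V ∶ U E C → Γ ⊢[ E ] force V ∶ C
    t-ret   : ∀ {V A} → Γ ⊢v V ∶ A → Γ ⊢[ E ] ret V ∶ F A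
    t-bind  : ∀ {M N A C} → Γ ⊢[ E ] M ∶ F A → (A ∷ Γ) ⊢[ E ] N ∶ C →
              Γ ⊢[ E ] bind M N ∶ C
    t-lam   : ∀ {M A C} → (A ∷ Γ) ⊢[ E ] M ∶ C → Γ ⊢[ E ] lam M ∶ (A ⇒ C)
    t-app   : ∀ {M V A C} → Γ ⊢[ E ] M ∶ (A ⇒ C) → Γ ⊢v V ∶ A → Γ ⊢[ E ] app M V ∶ C
    t-cpair : ∀ {M₁ M₂ C₁ C₂} → Γ ⊢[ E ] M₁ ∶ C₁ → Γ ⊢[ E ] M₂ ∶ C₂ →
              Γ ⊢[ E ] cpair M₁ M₂ ∶ (C₁ & C₂)
    t-prj₁  : ∀ {M C₁ C₂} → Γ ⊢[ E ] M ∶ (C₁ & C₂) → Γ ⊢[ E ] prj₁ M ∶ C₁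
    t-prj₂  : ∀ {M C₁ C₂} → Γ ⊢[ E ] M ∶ (C₁ & C₂) → Γ ⊢[ E ] prj₂ M ∶ C₂
    t-shift : ∀ {M A C E′} → E ≡ (C ∷ E′) → (U E′ (A ⇒ C) ∷ Γ) ⊢[ E′ ] M ∶ C →
              Γ ⊢[ E ] shift M ∶ F A
    t-reset : ∀ {M N A C} → Γ ⊢[ C ∷ E ] M ∶ F A → (A ∷ Γ) ⊢[ E ] N ∶ C →
              Γ ⊢[ E ] reset M N ∶ C

-- A logical relation indexed by the effect stack: for the empty stack a
-- computation of type F A is good when it reduces to a good value; for a stack
-- C ∷ E it is good when, placed in any hoisting context H under any reset
-- whose handler makes every H[return V] good, the whole reset is good at C
-- under E.  The shift rule is sound because the captured continuation
-- λy.⟨H[return y] | x.N⟩ is then a good function by construction.  The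
-- fundamental lemma makes every closed well-typed computation good, and a
-- good value of ground type is a closed well-typed value.
module Submission where

open import Defs
open import Data.List using (List; []; _∷_; _++_)
open import Data.List.Relation.Binary.Pointwise using (Pointwise; _∷_)
open import Data.List.Relation.Unary.All using (All; _∷_)
open import Data.Nat using (ℕ; zero; suc)
open import Data.Empty using (⊥)
open import Data.Product using (Σ; ∃; _×_; _,_; proj₁; proj₂)
open import Function using (_∘_; id)
open import Relation.Binary.PropositionalEquality
  using (_≡_; _≗_; refl; sym; trans; cong; cong₂; subst; subst₂; module ≡-Reasoning)
open import Relation.Binary.Construct.Closure.ReflexiveTransitive using (ε; _◅_)

open ≡-Reasoning

ext∘ext : ∀ {ρ₁ ρ₂ ρ} → ρ₂ ∘ ρ₁ ≗ ρ → ext ρ₂ ∘ ext ρ₁ ≗ ext ρ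
ext∘ext h zero    = refl
ext∘ext h (suc x) = cong suc (h x)

mutual
  renV∘renV : ∀ {ρ₁ ρ₂ ρ} → ρ₂ ∘ ρ₁ ≗ ρ → renV ρ₂ ∘ renV ρ₁ ≗ renV ρ
  renV∘renV h (var x)    = cong var (h x)
  renV∘renV h unit       = refl
  renV∘renV h (pair V W) = cong₂ pair (renV∘renV h V) (renV∘renV h W)
  renV∘renV h (inj i V)  = cong (inj i) (renV∘renV h V)
  renV∘renV h (thunk M)  = cong thunk (renC∘renC h M)

  renC∘renC : ∀ {ρ₁ ρ₂ ρ} → ρ₂ ∘ ρ₁ ≗ ρ → renC ρ₂ ∘ renC ρ₁ ≗ renC ρ
  renC∘renC h (letp V M)  = cong₂ letp (renV∘renV h V) (renC∘renC (ext∘ext (ext∘ext h)) M)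
  renC∘renC h (case V Ms) = cong₂ case (renV∘renV h V) (renBs∘renBs h Ms)
  renC∘renC h (force V)   = cong force (renV∘renV h V)
  renC∘renC h (ret V)     = cong ret (renV∘renV h V)
  renC∘renC h (bind M N)  = cong₂ bind (renC∘renC h M) (renC∘renC (ext∘ext h) N)
  renC∘renC h (lam M)     = cong lam (renC∘renC (ext∘ext h) M)
  renC∘renC h (app M V)   = cong₂ app (renC∘renC h M) (renV∘renV h V)
  renC∘renC h (cpair M N) = cong₂ cpair (renC∘renC h M) (renC∘renC h N)
  renC∘renC h (prj₁ M)    = cong prj₁ (renC∘renC h M)
  renC∘renC h (prj₂ M)    = cong prj₂ (renC∘renC h M)
  renC∘renC h (shift M)   = cong shift (renC∘renC (ext∘ext h) M)
  renC∘renC h (reset M N) = cong₂ reset (renC∘renC h M) (renC∘renC (ext∘ext h) N)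

  renBs∘renBs : ∀ {ρ₁ ρ₂ ρ} → ρ₂ ∘ ρ₁ ≗ ρ → renBs ρ₂ ∘ renBs ρ₁ ≗ renBs ρ
  renBs∘renBs h []       = refl
  renBs∘renBs h (M ∷ Ms) = cong₂ _∷_ (renC∘renC (ext∘ext h) M) (renBs∘renBs h Ms)

exts∘ext : ∀ {σ ρ τ} → σ ∘ ρ ≗ τ → exts σ ∘ ext ρ ≗ exts τ
exts∘ext h zero    = refl
exts∘ext h (suc x) = cong (renV suc) (h x)

mutual
  subV∘renV : ∀ {σ ρ τ} → σ ∘ ρ ≗ τ → subV σ ∘ renV ρ ≗ subV τ
  subV∘renV h (var x)    = h x
  subV∘renV h unit       = refl
  subV∘renV h (pair V W) = cong₂ pair (subV∘renV h V) (subV∘renV h W)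
  subV∘renV h (inj i V)  = cong (inj i) (subV∘renV h V)
  subV∘renV h (thunk M)  = cong thunk (subC∘renC h M)

  subC∘renC : ∀ {σ ρ τ} → σ ∘ ρ ≗ τ → subC σ ∘ renC ρ ≗ subC τ
  subC∘renC h (letp V M)  = cong₂ letp (subV∘renV h V) (subC∘renC (exts∘ext (exts∘ext h)) M)
  subC∘renC h (case V Ms) = cong₂ case (subV∘renV h V) (subBs∘renBs h Ms)
  subC∘renC h (force V)   = cong force (subV∘renV h V)
  subC∘renC h (ret V)     = cong ret (subV∘renV h V)
  subC∘renC h (bind M N)  = cong₂ bind (subC∘renC h M) (subC∘renC (exts∘ext h) N)
  subC∘renC h (lam M)     = cong lam (subC∘renC (exts∘ext h) M)
  subC∘renC h (app M V)   = cong₂ app (subC∘renC h M) (subV∘renV h V)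
  subC∘renC h (cpair M N) = cong₂ cpair (subC∘renC h M) (subC∘renC h N)
  subC∘renC h (prj₁ M)    = cong prj₁ (subC∘renC h M)
  subC∘renC h (prj₂ M)    = cong prj₂ (subC∘renC h M)
  subC∘renC h (shift M)   = cong shift (subC∘renC (exts∘ext h) M)
  subC∘renC h (reset M N) = cong₂ reset (subC∘renC h M) (subC∘renC (exts∘ext h) N)

  subBs∘renBs : ∀ {σ ρ τ} → σ ∘ ρ ≗ τ → subBs σ ∘ renBs ρ ≗ subBs τ
  subBs∘renBs h []       = refl
  subBs∘renBs h (M ∷ Ms) = cong₂ _∷_ (subC∘renC (exts∘ext h) M) (subBs∘renBs h Ms)

ext∘exts : ∀ {ρ σ τ} → renV ρ ∘ σ ≗ τ → renV (ext ρ) ∘ exts σ ≗ exts τ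
ext∘exts         h zero    = refl
ext∘exts {ρ} {σ} {τ} h (suc x) = begin
  renV (ext ρ) (renV suc (σ x)) ≡⟨ renV∘renV (λ _ → refl) (σ x) ⟩
  renV (suc ∘ ρ) (σ x)          ≡⟨ renV∘renV (λ _ → refl) (σ x) ⟨
  renV suc (renV ρ (σ x))       ≡⟨ cong (renV suc) (h x) ⟩
  renV suc (τ x)                ∎

mutual
  renV∘subV : ∀ {ρ σ τ} → renV ρ ∘ σ ≗ τ → renV ρ ∘ subV σ ≗ subV τ
  renV∘subV h (var x)    = h x
  renV∘subV h unit       = refl
  renV∘subV h (pair V W) = cong₂ pair (renV∘subV h V) (renV∘subV h W)
  renV∘subV h (inj i V)  = cong (inj i) (renV∘subV h V)
  renV∘subV h (thunk M)  = cong thunk (renC∘subC h M)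

  renC∘subC : ∀ {ρ σ τ} → renV ρ ∘ σ ≗ τ → renC ρ ∘ subC σ ≗ subC τ
  renC∘subC h (letp V M)  = cong₂ letp (renV∘subV h V) (renC∘subC (ext∘exts (ext∘exts h)) M)
  renC∘subC h (case V Ms) = cong₂ case (renV∘subV h V) (renBs∘subBs h Ms)
  renC∘subC h (force V)   = cong force (renV∘subV h V)
  renC∘subC h (ret V)     = cong ret (renV∘subV h V)
  renC∘subC h (bind M N)  = cong₂ bind (renC∘subC h M) (renC∘subC (ext∘exts h) N)
  renC∘subC h (lam M)     = cong lam (renC∘subC (ext∘exts h) M)
  renC∘subC h (app M V)   = cong₂ app (renC∘subC h M) (renV∘subV h V)
  renC∘subC h (cpair M N) = cong₂ cpair (renC∘subC h M) (renC∘subC h N)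
  renC∘subC h (prj₁ M)    = cong prj₁ (renC∘subC h M)
  renC∘subC h (prj₂ M)    = cong prj₂ (renC∘subC h M)
  renC∘subC h (shift M)   = cong shift (renC∘subC (ext∘exts h) M)
  renC∘subC h (reset M N) = cong₂ reset (renC∘subC h M) (renC∘subC (ext∘exts h) N)

  renBs∘subBs : ∀ {ρ σ τ} → renV ρ ∘ σ ≗ τ → renBs ρ ∘ subBs σ ≗ subBs τ
  renBs∘subBs h []       = refl
  renBs∘subBs h (M ∷ Ms) = cong₂ _∷_ (renC∘subC (ext∘exts h) M) (renBs∘subBs h Ms)

exts∘exts : ∀ {σ₁ σ₂ τ} → subV σ₂ ∘ σ₁ ≗ τ → subV (exts σ₂) ∘ exts σ₁ ≗ exts τ
exts∘exts                h zero    = refl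
exts∘exts {σ₁} {σ₂} {τ} h (suc x) = begin
  subV (exts σ₂) (renV suc (σ₁ x)) ≡⟨ subV∘renV (λ _ → refl) (σ₁ x) ⟩
  subV (renV suc ∘ σ₂) (σ₁ x)      ≡⟨ renV∘subV (λ _ → refl) (σ₁ x) ⟨
  renV suc (subV σ₂ (σ₁ x))        ≡⟨ cong (renV suc) (h x) ⟩
  renV suc (τ x)                   ∎

mutual
  subV∘subV : ∀ {σ₁ σ₂ τ} → subV σ₂ ∘ σ₁ ≗ τ → subV σ₂ ∘ subV σ₁ ≗ subV τ
  subV∘subV h (var x)    = h x
  subV∘subV h unit       = refl
  subV∘subV h (pair V W) = cong₂ pair (subV∘subV h V) (subV∘subV h W)
  subV∘subV h (inj i V)  = cong (inj i) (subV∘subV h V)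
  subV∘subV h (thunk M)  = cong thunk (subC∘subC h M)

  subC∘subC : ∀ {σ₁ σ₂ τ} → subV σ₂ ∘ σ₁ ≗ τ → subC σ₂ ∘ subC σ₁ ≗ subC τ
  subC∘subC h (letp V M)  = cong₂ letp (subV∘subV h V) (subC∘subC (exts∘exts (exts∘exts h)) M)
  subC∘subC h (case V Ms) = cong₂ case (subV∘subV h V) (subBs∘subBs h Ms)
  subC∘subC h (force V)   = cong force (subV∘subV h V)
  subC∘subC h (ret V)     = cong ret (subV∘subV h V)
  subC∘subC h (bind M N)  = cong₂ bind (subC∘subC h M) (subC∘subC (exts∘exts h) N)
  subC∘subC h (lam M)     = cong lam (subC∘subC (exts∘exts h) M)
  subC∘subC h (app M V)   = cong₂ app (subC∘subC h M) (subV∘subV h V)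
  subC∘subC h (cpair M N) = cong₂ cpair (subC∘subC h M) (subC∘subC h N)
  subC∘subC h (prj₁ M)    = cong prj₁ (subC∘subC h M)
  subC∘subC h (prj₂ M)    = cong prj₂ (subC∘subC h M)
  subC∘subC h (shift M)   = cong shift (subC∘subC (exts∘exts h) M)
  subC∘subC h (reset M N) = cong₂ reset (subC∘subC h M) (subC∘subC (exts∘exts h) N)

  subBs∘subBs : ∀ {σ₁ σ₂ τ} → subV σ₂ ∘ σ₁ ≗ τ → subBs σ₂ ∘ subBs σ₁ ≗ subBs τ
  subBs∘subBs h []       = refl
  subBs∘subBs h (M ∷ Ms) = cong₂ _∷_ (subC∘subC (exts∘exts h) M) (subBs∘subBs h Ms)

exts-var : ∀ {σ} → σ ≗ var → exts σ ≗ var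
exts-var h zero    = refl
exts-var h (suc x) = cong (renV suc) (h x)

mutual
  subV-var : ∀ {σ} → σ ≗ var → subV σ ≗ id
  subV-var h (var x)    = h x
  subV-var h unit       = refl
  subV-var h (pair V W) = cong₂ pair (subV-var h V) (subV-var h W)
  subV-var h (inj i V)  = cong (inj i) (subV-var h V)
  subV-var h (thunk M)  = cong thunk (subC-var h M)

  subC-var : ∀ {σ} → σ ≗ var → subC σ ≗ id
  subC-var h (letp V M)  = cong₂ letp (subV-var h V) (subC-var (exts-var (exts-var h)) M)
  subC-var h (case V Ms) = cong₂ case (subV-var h V) (subBs-var h Ms)
  subC-var h (force V)   = cong force (subV-var h V)
  subC-var h (ret V)     = cong ret (subV-var h V)
  subC-var h (bind M N)  = cong₂ bind (subC-var h M) (subC-var (exts-var h) N)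
  subC-var h (lam M)     = cong lam (subC-var (exts-var h) M)
  subC-var h (app M V)   = cong₂ app (subC-var h M) (subV-var h V)
  subC-var h (cpair M N) = cong₂ cpair (subC-var h M) (subC-var h N)
  subC-var h (prj₁ M)    = cong prj₁ (subC-var h M)
  subC-var h (prj₂ M)    = cong prj₂ (subC-var h M)
  subC-var h (shift M)   = cong shift (subC-var (exts-var h) M)
  subC-var h (reset M N) = cong₂ reset (subC-var h M) (subC-var (exts-var h) N)

  subBs-var : ∀ {σ} → σ ≗ var → subBs σ ≗ id
  subBs-var h []       = refl
  subBs-var h (M ∷ Ms) = cong₂ _∷_ (subC-var (exts-var h) M) (subBs-var h Ms)

subV-renV-cancel : ∀ {σ ρ} → σ ∘ ρ ≗ var → subV σ ∘ renV ρ ≗ id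
subV-renV-cancel h V = trans (subV∘renV (λ _ → refl) V) (subV-var h V)

subC-renC-cancel : ∀ {σ ρ} → σ ∘ ρ ≗ var → subC σ ∘ renC ρ ≗ id
subC-renC-cancel h M = trans (subC∘renC (λ _ → refl) M) (subC-var h M)

infixr 5 _•_

_•_ : Val → (ℕ → Val) → ℕ → Val
(V • σ) zero    = V
(V • σ) (suc n) = σ n

exts-[] : ∀ σ W M → subC (exts σ) M [ W ] ≡ subC (W • σ) M
exts-[] σ W = subC∘subC single-exts
  where
  single-exts : subV (single W) ∘ exts σ ≗ W • σ
  single-exts zero    = refl
  single-exts (suc x) = subV-renV-cancel (λ _ → refl) (σ x)

exts²-double : ∀ σ V₁ V₂ M →
               subC (double V₁ V₂) (subC (exts (exts σ)) M) ≡ subC (V₂ • V₁ • σ) M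
exts²-double σ V₁ V₂ = subC∘subC double-exts²
  where
  double∘suc : double V₁ V₂ ∘ suc ≗ single V₁
  double∘suc zero    = refl
  double∘suc (suc x) = refl

  double-exts² : subV (double V₁ V₂) ∘ exts (exts σ) ≗ V₂ • V₁ • σ
  double-exts² zero          = refl
  double-exts² (suc zero)    = refl
  double-exts² (suc (suc x)) =
    trans (subV∘renV double∘suc (renV suc (σ x))) (subV-renV-cancel (λ _ → refl) (σ x))

exts-single∘ext-suc : ∀ V → exts (single V) ∘ ext suc ≗ var
exts-single∘ext-suc V zero    = refl
exts-single∘ext-suc V (suc x) = refl

plugB-renF-[] : ∀ B M V → plugB (renF suc B) M [ V ] ≡ plugB B (M [ V ])
plugB-renF-[] (bindF N) M V = cong (bind (M [ V ])) (subC-renC-cancel (exts-single∘ext-suc V) N)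
plugB-renF-[] (appF W)  M V = cong (app (M [ V ])) (subV-renV-cancel (λ _ → refl) W)
plugB-renF-[] prj₁F     M V = refl
plugB-renF-[] prj₂F     M V = refl

plugH-renH-[] : ∀ H M V → plugH (renH suc H) M [ V ] ≡ plugH H (M [ V ])
plugH-renH-[] []      M V = refl
plugH-renH-[] (B ∷ H) M V =
  trans (plugH-renH-[] H (plugB (renF suc B) M) V) (cong (plugH H) (plugB-renF-[] B M V))

plugH-++ : ∀ H H′ M → plugH (H ++ H′) M ≡ plugH H′ (plugH H M)
plugH-++ []      H′ M = refl
plugH-++ (B ∷ H) H′ M = plugH-++ H H′ (plugB B M)

continuation : Hoist → Comp → Val
continuation H N = thunk (lam (reset (plugH (renH suc H) (ret (var zero))) (renC (ext suc) N)))

plugK-snoc : ∀ K f M → plugK (K ++ f ∷ []) M ≡ plugE f (plugK K M)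
plugK-snoc []      f M = refl
plugK-snoc (g ∷ K) f M = plugK-snoc K f (plugE g M)

β⟶ : ∀ {M N} → M →β N → M ⟶ N
β⟶ = step []

⟶-plugE : ∀ f {M M′} → M ⟶ M′ → plugE f M ⟶ plugE f M′
⟶-plugE f (step K r) = subst₂ _⟶_ (plugK-snoc K f _) (plugK-snoc K f _) (step (K ++ f ∷ []) r)

⟶-plugH : ∀ H {M M′} → M ⟶ M′ → plugH H M ⟶ plugH H M′
⟶-plugH []      r = r
⟶-plugH (B ∷ H) r = ⟶-plugH H (⟶-plugE (basic B) r)

⟶*-plugH : ∀ H {M M′} → M ⟶* M′ → plugH H M ⟶* plugH H M′
⟶*-plugH H ε        = ε
⟶*-plugH H (r ◅ rs) = ⟶-plugH H r ◅ ⟶*-plugH H rs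

-- The logical relation

mutual
  𝒱 : VTy 0 → Val → Set
  𝒱 (tvar ())
  𝒱 𝟙            V = V ≡ unit
  𝒱 (A ⊗ B)      V = Σ Val λ V₁ → Σ Val λ V₂ → V ≡ pair V₁ V₂ × 𝒱 A V₁ × 𝒱 B V₂
  𝒱 (variant As) V = Σ ℕ λ i → Σ Val λ W → V ≡ inj i W × 𝒱-at As i W
  𝒱 (U E C)      V = 𝒞 E C (force V)

  𝒱-at : List (VTy 0) → ℕ → Val → Set
  𝒱-at []       i       W = ⊥
  𝒱-at (A ∷ As) zero    W = 𝒱 A W
  𝒱-at (A ∷ As) (suc i) W = 𝒱-at As i W

  𝒞 : Eff 0 → CTy 0 → Comp → Set
  𝒞 E (F A)     M = 𝒞F E A M
  𝒞 E (A ⇒ C)   M = ∀ V → 𝒱 A V → 𝒞 E C (app M V)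
  𝒞 E (C₁ & C₂) M = 𝒞 E C₁ (prj₁ M) × 𝒞 E C₂ (prj₂ M)

  𝒞F : Eff 0 → VTy 0 → Comp → Set
  𝒞F []      A M = Σ Val λ V → M ⟶* ret V × 𝒱 A V
  𝒞F (C ∷ E) A M = ∀ H N → (∀ V → 𝒱 A V → 𝒞 E C (reset (plugH H (ret V)) N)) →
                    𝒞 E C (reset (plugH H M) N)

𝒞-expand : ∀ {E} C {M M′} → M ⟶ M′ → 𝒞 E C M′ → 𝒞 E C M
𝒞-expand {[]}    (F A)     r (V , M′⟶*V , v) = V , r ◅ M′⟶*V , v
𝒞-expand {C ∷ E} (F A)     r m H N k = 𝒞-expand C (⟶-plugE (resetF N) (⟶-plugH H r)) (m H N k)
𝒞-expand         (A ⇒ C)   r m V v   = 𝒞-expand C (⟶-plugE (basic (appF V)) r) (m V v)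
𝒞-expand         (C₁ & C₂) r (m₁ , m₂) =
  𝒞-expand C₁ (⟶-plugE (basic prj₁F) r) m₁ , 𝒞-expand C₂ (⟶-plugE (basic prj₂F) r) m₂

𝒞-expand* : ∀ {E} C {M M′} → M ⟶* M′ → 𝒞 E C M′ → 𝒞 E C M
𝒞-expand* C ε        m = m
𝒞-expand* C (r ◅ rs) m = 𝒞-expand C r (𝒞-expand* C rs m)

𝒞-ret : ∀ E {A V} → 𝒱 A V → 𝒞 E (F A) (ret V)
𝒞-ret []      v       = _ , ε , v
𝒞-ret (C ∷ E) v H N k = k _ v

mutual
  𝒞-plugH : ∀ E C {A} H {M} → 𝒞 E (F A) M → (∀ V → 𝒱 A V → 𝒞 E C (plugH H (ret V))) →
            𝒞 E C (plugH H M)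
  𝒞-plugH [] C H (V , M⟶*V , v) k = 𝒞-expand* C (⟶*-plugH H M⟶*V) (k V v)
  𝒞-plugH (C₁ ∷ E) (F B) H {M} m k H′ N k′ =
    subst (λ X → 𝒞 E C₁ (reset X N)) (plugH-++ H H′ M)
      (m (H ++ H′) N λ V v →
        subst (λ X → 𝒞 E C₁ (reset X N)) (sym (plugH-++ H H′ (ret V))) (k V v H′ N k′))
  𝒞-plugH E@(_ ∷ _) (A′ ⇒ C) {A} H m k W w =
    𝒞-plugH-frame E C {A} H (appF W) m λ V v → k V v W w
  𝒞-plugH E@(_ ∷ _) (C₁ & C₂) {A} H m k =
    𝒞-plugH-frame E C₁ {A} H prj₁F m (λ V v → proj₁ (k V v)) ,
    𝒞-plugH-frame E C₂ {A} H prj₂F m (λ V v → proj₂ (k V v))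

  𝒞-plugH-frame : ∀ E C {A} H B {M} → 𝒞 E (F A) M →
                  (∀ V → 𝒱 A V → 𝒞 E C (plugB B (plugH H (ret V)))) →
                  𝒞 E C (plugB B (plugH H M))
  𝒞-plugH-frame E C H B {M} m k =
    subst (𝒞 E C) (plugH-++ H (B ∷ []) M)
      (𝒞-plugH E C (H ++ B ∷ []) m λ V v →
        subst (𝒞 E C) (sym (plugH-++ H (B ∷ []) (ret V))) (k V v))

𝒱-continuation : ∀ {E A C} H N → (∀ V → 𝒱 A V → 𝒞 E C (reset (plugH H (ret V)) N)) →
                 𝒱 (U E (A ⇒ C)) (continuation H N)
𝒱-continuation {C = C} H N k V v =
  𝒞-expand C (⟶-plugE (basic (appF V)) (β⟶ β-force))
    (𝒞-expand C (β⟶ β-app) (subst (𝒞 _ C) (sym body-[]) (k V v)))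
  where
  body-[] : reset (plugH (renH suc H) (ret (var zero))) (renC (ext suc) N) [ V ] ≡
            reset (plugH H (ret V)) N
  body-[] = cong₂ reset (plugH-renH-[] H (ret (var zero)) V)
                        (subC-renC-cancel (exts-single∘ext-suc V) N)

-- The fundamental lemma

𝒢 : List (VTy 0) → (ℕ → Val) → Set
𝒢 Γ σ = ∀ {x A} → Γ ∋ x ∶ A → 𝒱 A (σ x)

𝒢-[] : 𝒢 [] var
𝒢-[] ()

𝒢-• : ∀ {Γ σ A V} → 𝒢 Γ σ → 𝒱 A V → 𝒢 (A ∷ Γ) (V • σ)
𝒢-• γ v here      = v
𝒢-• γ v (there p) = γ p

𝒱-at-∋ : ∀ {As i A W} → As ∋ i ∶ A → 𝒱 A W → 𝒱-at As i W
𝒱-at-∋ here      w = w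
𝒱-at-∋ (there p) w = 𝒱-at-∋ p w

mutual
  fundamentalV : ∀ {Γ V A} → Γ ⊢v V ∶ A → ∀ σ → 𝒢 Γ σ → 𝒱 A (subV σ V)
  fundamentalV (t-var p)            σ γ = γ p
  fundamentalV t-unit               σ γ = refl
  fundamentalV (t-pair d₁ d₂)       σ γ = _ , _ , refl , fundamentalV d₁ σ γ , fundamentalV d₂ σ γ
  fundamentalV (t-inj p d)          σ γ = _ , _ , refl , 𝒱-at-∋ p (fundamentalV d σ γ)
  fundamentalV (t-thunk {C = C} d)  σ γ = 𝒞-expand C (β⟶ β-force) (fundamentalC d σ γ)

  fundamentalC : ∀ {Γ E M C} → Γ ⊢[ E ] M ∶ C → ∀ σ → 𝒢 Γ σ → 𝒞 E C (subC σ M)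
  fundamentalC {C = C} (t-letp {V} {M} dV dM) σ γ with subV σ V | fundamentalV dV σ γ
  ... | _ | V₁ , V₂ , refl , v₁ , v₂ =
    𝒞-expand C (β⟶ β-letp) (subst (𝒞 _ C) (sym (exts²-double σ V₁ V₂ M))
      (fundamentalC dM (V₂ • V₁ • σ) (𝒢-• (𝒢-• γ v₁) v₂)))
  fundamentalC {C = C} (t-case {V} dV dMs) σ γ with subV σ V | fundamentalV dV σ γ
  ... | _ | i , W , refl , w with fundamental-case dMs w γ
  ... | Mᵢ , Mᵢ∈Ms , m = 𝒞-expand C (β⟶ (β-case Mᵢ∈Ms)) m
  fundamentalC (t-force dV)  σ γ = fundamentalV dV σ γ
  fundamentalC {E = E} (t-ret dV) σ γ = 𝒞-ret E (fundamentalV dV σ γ)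
  fundamentalC {E = E} {C = C} (t-bind dM dN) σ γ =
    𝒞-plugH E C (bindF _ ∷ []) (fundamentalC dM σ γ) λ V v →
      𝒞-expand C (β⟶ β-bind) (fundamental-under dN γ v)
  fundamentalC (t-lam {C = C} dM) σ γ V v = 𝒞-expand C (β⟶ β-app) (fundamental-under dM γ v)
  fundamentalC (t-app dM dV) σ γ = fundamentalC dM σ γ _ (fundamentalV dV σ γ)
  fundamentalC (t-cpair {C₁ = C₁} {C₂} d₁ d₂) σ γ =
    𝒞-expand C₁ (β⟶ β-prj₁) (fundamentalC d₁ σ γ) , 𝒞-expand C₂ (β⟶ β-prj₂) (fundamentalC d₂ σ γ)
  fundamentalC (t-prj₁ d) σ γ = proj₁ (fundamentalC d σ γ)
  fundamentalC (t-prj₂ d) σ γ = proj₂ (fundamentalC d σ γ)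
  fundamentalC (t-shift {A = A} {C} {E′} refl dM) σ γ H N k =
    𝒞-expand C (β⟶ (β-shift {H})) (fundamental-under dM γ (𝒱-continuation {E′} {A} {C} H N k))
  fundamentalC {C = C} (t-reset dM dN) σ γ =
    fundamentalC dM σ γ [] _ λ V v → 𝒞-expand C (β⟶ β-reset) (fundamental-under dN γ v)

  fundamental-under : ∀ {Γ E A C N σ W} → (A ∷ Γ) ⊢[ E ] N ∶ C → 𝒢 Γ σ → 𝒱 A W →
                      𝒞 E C (subC (exts σ) N [ W ])
  fundamental-under {C = C} {N} {σ} {W} d γ w =
    subst (𝒞 _ C) (sym (exts-[] σ W N)) (fundamentalC d (W • σ) (𝒢-• γ w))

  fundamental-case : ∀ {Γ E C As Ms i W σ} → Pointwise (λ A M → (A ∷ Γ) ⊢[ E ] M ∶ C) As Ms →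
                     𝒱-at As i W → 𝒢 Γ σ →
                     Σ Comp λ Mᵢ → lookupC (subBs σ Ms) i Mᵢ × 𝒞 E C (Mᵢ [ W ])
  fundamental-case {i = zero}  (d ∷ ds) w γ = _ , refl , fundamental-under d γ w
  fundamental-case {i = suc i} (d ∷ ds) w γ = fundamental-case ds w γ

mutual
  𝒱-ground-typed : ∀ {G V} → Ground G → 𝒱 G V → [] ⊢v V ∶ G
  𝒱-ground-typed g-unit         refl                    = t-unit
  𝒱-ground-typed (g-pair g₁ g₂) (_ , _ , refl , v₁ , v₂) =
    t-pair (𝒱-ground-typed g₁ v₁) (𝒱-ground-typed g₂ v₂)
  𝒱-ground-typed (g-variant gs) (_ , _ , refl , w) with 𝒱-at-ground-typed gs w
  ... | _ , p , d = t-inj p d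

  𝒱-at-ground-typed : ∀ {Gs i W} → All Ground Gs → 𝒱-at Gs i W →
                      Σ (VTy 0) λ G → Gs ∋ i ∶ G × [] ⊢v W ∶ G
  𝒱-at-ground-typed {i = zero}  (g ∷ gs) w = _ , here , 𝒱-ground-typed g w
  𝒱-at-ground-typed {i = suc i} (g ∷ gs) w with 𝒱-at-ground-typed gs w
  ... | G , p , d = G , there p , d

corollary6p3 : (M : Comp) (G : VTy 0) → Ground G →
    [] ⊢[ [] ] M ∶ F G →
    ∃ λ V → ([] ⊢v V ∶ G) × (M ⟶* ret V)
corollary6p3 M G g d with fundamentalC d var 𝒢-[]
... | V , M⟶*V , v = V , 𝒱-ground-typed g v , subst (_⟶* ret V) (subC-var (λ _ → refl) M) M⟶*V
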